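{- Let $\mathcal{G}$ be a bipartite graph. Then $\mathcal{G}$ is isomorphic to $B(X)$ for some non-empty set $X$ of positive integers if and only if $\mathcal{G}$ is non-empty and has no isolated vertices.
   Context: A graph is called bipartite if there is a bipartition $\{V_1\mid V_2\}$ of its vertex set with both $V_1,V_2$ non-empty such that every edge joins a vertex of $V_1$ to a vertex of $V_2$. An empty graph is a graph with at least one vertex and no edges; "non-empty" means not an empty graph. A vertex is isolated if it lies on no edge. For a non-empty set $X$ of positive integers, let $\rho(X)$ be the set of primes dividing some element of $X$, and $X^*=X\setminus\{1\}$. The bipartite divisor graph $B(X)$ has vertex set the disjoint union $\rho(X)\cup X^*$, and its edges are the pairs $\{p,x\}$ with $p\in\rho(X)$, $x\in X^*$ and $p\mid x$. -}

module Defs where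

open import Data.Nat using (ℕ; _<_; _≟_)
open import Data.Nat.Divisibility using (_∣_; _∣?_)
open import Data.Nat.Primality using (prime?)
open import Data.Bool using (Bool; true; false; T; _∧_; not)
open import Data.List using (List; [])
open import Data.Bool.ListAction using (any)
open import Data.List.Relation.Unary.All using (All)
open import Data.Fin using (Fin)
open import Data.Product using (Σ; ∃; _×_; _,_)
open import Data.Sum using (_⊎_; inj₁; inj₂)
open import Data.Empty using (⊥)
open import Data.Unit using (⊤)
open import Relation.Nullary using (¬_; Dec)
open import Relation.Nullary.Decidable using (⌊_⌋)
open import Relation.Binary.PropositionalEquality using (_≡_; _≢_)
open import Function.Bundles using (_↔_; Inverse; _⇔_)

record Graph : Set₁ where
  field
    V      : Set
    Adj    : V → V → Set
    sym    : ∀ {u v} → Adj u v → Adj v u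
    irrefl : ∀ {v} → ¬ Adj v v
    adj?   : ∀ u v → Dec (Adj u v)
    size   : ℕ
    enum   : Fin size ↔ V
open Graph public

-- Bipartite: a bipartition {V1 | V2} (coded by a colouring c, V1 = c⁻¹ true,
-- V2 = c⁻¹ false), both parts non-empty, every edge joins V1 to V2.
Bipartite : Graph → Set
Bipartite G = Σ (V G → Bool) λ c →
  (∃ λ v → c v ≡ true) × (∃ λ v → c v ≡ false) ×
  (∀ u v → Adj G u v → c u ≢ c v)

IsEmptyGraph : Graph → Set
IsEmptyGraph G = V G × (∀ u v → ¬ Adj G u v)

NonEmptyGraph : Graph → Set
NonEmptyGraph G = ¬ IsEmptyGraph G

Isolated : (G : Graph) → V G → Set
Isolated G v = ∀ u → ¬ Adj G v u

NoIsolatedVertices : Graph → Set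
NoIsolatedVertices G = ∀ v → ¬ Isolated G v

-- Bipartite divisor graph B(X), X a finite set of naturals given as a list
-- (membership is the only thing that matters; duplicates are irrelevant).

inX : List ℕ → ℕ → Bool
inX X n = any (λ x → ⌊ n ≟ x ⌋) X

inX* : List ℕ → ℕ → Bool
inX* X n = inX X n ∧ not ⌊ n ≟ 1 ⌋

inρ : List ℕ → ℕ → Bool
inρ X p = ⌊ prime? p ⌋ ∧ any (λ x → ⌊ p ∣? x ⌋) X

BVertex : List ℕ → Set
BVertex X = (Σ ℕ λ p → T (inρ X p)) ⊎ (Σ ℕ λ x → T (inX* X x))

BAdj : (X : List ℕ) → BVertex X → BVertex X → Set
BAdj X (inj₁ (p , _)) (inj₂ (x , _)) = p ∣ x
BAdj X (inj₂ (x , _)) (inj₁ (p , _)) = p ∣ x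
BAdj X (inj₁ _) (inj₁ _) = ⊥
BAdj X (inj₂ _) (inj₂ _) = ⊥

NonEmptyPositive : List ℕ → Set
NonEmptyPositive X = X ≢ [] × All (λ x → 0 < x) X

Iso : (G : Graph) (W : Set) → (W → W → Set) → Set
Iso G W AdjW = Σ (V G ↔ W) λ f →
  ∀ u v → Adj G u v ⇔ AdjW (Inverse.to f u) (Inverse.to f v)

IsoToB : Graph → List ℕ → Set
IsoToB G X = Iso G (BVertex X) (BAdj X)

-- Forward: in B(X) every prime of ρ(X) divides some x ∈ X, which is not 1, and every
-- x ∈ X* has a prime factor, so B(X) has no isolated vertices; being non-empty is then
-- automatic.  Backward: give each vertex v of G its own prime p_v and let the vertices
-- of one side of the bipartition become the numbers x_v = (∏_{u ~ v} p_u)^(i_v + 1),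
-- where i_v is the index of v.  The primes dividing x_v are exactly the p_u with u ~ v,
-- and the exponent separates vertices with the same neighbourhood.
module Submission where

open import Defs hiding (sym)
open import Data.Bool as Bool using (Bool; true; false; T; not)
open import Data.Bool.Properties using (T-∧; T-irrelevant; ¬-not)
open import Data.Bool.ListAction using (any)
open import Data.Empty using (⊥-elim)
open import Data.Fin using (Fin; toℕ)
open import Data.Fin.Properties using (toℕ-injective)
open import Data.List using (List; []; _∷_; map; filter; tabulate)
open import Data.List.Membership.Propositional using (_∈_; find; lose)
open import Data.List.Membership.Propositional.Properties
  using (∈-map⁺; ∈-filter⁺; ∈-map∘filter⁻; ∈-tabulate⁺)
open import Data.List.Properties using (filter-≐)
open import Data.List.Relation.Unary.All as All using (All)
open import Data.List.Relation.Unary.All.Properties using (map⁺)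
open import Data.List.Relation.Unary.Any as Any using (here)
open import Data.List.Relation.Unary.Any.Properties using (any⇔)
open import Data.Nat
open import Data.Nat.Divisibility
open import Data.Nat.ListAction using (product)
open import Data.Nat.ListAction.Properties using (∈⇒∣product)
open import Data.Nat.Primality
open import Data.Nat.Primality.Factorisation
  using (factorise; factorisationHasAllPrimeFactors)
open import Data.Nat.Properties
open import Data.Product using (Σ; ∃; ∃-syntax; _×_; _,_; proj₁; proj₂)
import Data.Product as Product
open import Data.Product.Properties using (,-injectiveˡ)
open import Data.Sum using (inj₁; inj₂)
open import Data.Sum.Properties using (inj₁-injective; inj₂-injective)
open import Function using (_∘_)
open import Function.Bundles using (Inverse; _⇔_; mk⇔; Equivalence; mk⤖)
open import Function.Properties.Bijection using (⤖⇒↔)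
import Function.Properties.Equivalence
open import Relation.Binary.Definitions using (tri<; tri≈; tri>)
open import Relation.Binary.PropositionalEquality
  using (_≡_; _≢_; refl; sym; trans; cong; subst; subst₂; module ≡-Reasoning)
open import Relation.Nullary using (yes; no)
open import Relation.Nullary.Decidable
  using (⌊_⌋; toWitness; fromWitness; toWitnessFalse; fromWitnessFalse)
open import Relation.Unary using (Decidable; _≐_)

private
  variable
    m n p q : ℕ

prime∤1 : Prime p → p ∤ 1
prime∤1 pp p∣1 = ¬prime[1] (subst Prime (∣1⇒≡1 p∣1) pp)

prime∣⇒1< : Prime p → p ∣ n → .{{NonZero n}} → 1 < n
prime∣⇒1< {p} pp p∣n = <-≤-trans (nonTrivial⇒n>1 p {{prime⇒nonTrivial pp}}) (∣⇒≤ p∣n)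

primeFactor : 1 < n → ∃[ p ] Prime p × p ∣ n
primeFactor {n} 1<n with factorise n {{>-nonZero (<-trans z<s 1<n)}}
... | record { factors = [] ; isFactorisation = n≡1 } = ⊥-elim (<⇒≢ 1<n (sym n≡1))
... | record { factors = p ∷ ps ; isFactorisation = n≡Π ; factorsPrime = pp All.∷ _ } =
  p , pp , subst (p ∣_) (sym n≡Π) (∈⇒∣product {ns = p ∷ ps} (here refl))

n∣n! : ∀ n → .{{NonZero n}} → n ∣ n !
n∣n! (suc n) = m∣m*n (n !)

-- Euclid: a prime factor of m ! + 1 does not divide m !, so it exceeds m.
primeAbove : ∀ m → ∃[ p ] Prime p × m < p
primeAbove m with primeFactor (+-monoˡ-≤ 1 (1≤n! m))
... | p , pp , p∣m!+1 with m <? p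
...   | yes m<p = p , pp , m<p
...   | no  m≮p = ⊥-elim (prime∤1 pp (∣m+n∣m⇒∣n p∣m!+1 (p∣m! (≮⇒≥ m≮p))))
  where
  p∣m! : p ≤ m → p ∣ m !
  p∣m! p≤m = ∣-trans (n∣n! p {{prime⇒nonZero pp}}) (m≤n⇒m!∣n! p≤m)

prime∣m^n⇒prime∣m : ∀ n → Prime p → p ∣ m ^ n → p ∣ m
prime∣m^n⇒prime∣m zero    pp p∣1 = ⊥-elim (prime∤1 pp p∣1)
prime∣m^n⇒prime∣m {m = m} (suc n) pp p∣m^1+n with euclidsLemma m (m ^ n) pp p∣m^1+n
... | inj₁ p∣m   = p∣m
... | inj₂ p∣m^n = prime∣m^n⇒prime∣m n pp p∣m^n

<-preserving⇒injective : (f : ℕ → ℕ) → (∀ {k l} → k < l → f k < f l) →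
                         ∀ {k l} → f k ≡ f l → k ≡ l
<-preserving⇒injective f mono {k} {l} fk≡fl with <-cmp k l
... | tri< k<l _ _ = ⊥-elim (<⇒≢ (mono k<l) fk≡fl)
... | tri≈ _ k≡l _ = k≡l
... | tri> _ _ l<k = ⊥-elim (<⇒≢ (mono l<k) (sym fk≡fl))

stepwise<⇒<-preserving : (f : ℕ → ℕ) → (∀ k → f k < f (suc k)) → ∀ {k l} → k < l → f k < f l
stepwise<⇒<-preserving f step {k} {suc l} k<1+l with m≤n⇒m<n∨m≡n (s≤s⁻¹ k<1+l)
... | inj₁ k<l  = <-trans (stepwise<⇒<-preserving f step k<l) (step l)
... | inj₂ refl = step l

^-injectiveʳ : 1 < m → ∀ {k l} → m ^ k ≡ m ^ l → k ≡ l
^-injectiveʳ {m} 1<m = <-preserving⇒injective (m ^_) (^-monoʳ-< m 1<m)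

nthPrime : ℕ → ℕ
nthPrime zero    = 2
nthPrime (suc k) = proj₁ (primeAbove (nthPrime k))

nthPrime-prime : ∀ k → Prime (nthPrime k)
nthPrime-prime zero    = prime[2]
nthPrime-prime (suc k) = proj₁ (proj₂ (primeAbove (nthPrime k)))

nthPrime<nthPrime[1+k] : ∀ k → nthPrime k < nthPrime (suc k)
nthPrime<nthPrime[1+k] k = proj₂ (proj₂ (primeAbove (nthPrime k)))

nthPrime-injective : ∀ {k l} → nthPrime k ≡ nthPrime l → k ≡ l
nthPrime-injective =
  <-preserving⇒injective nthPrime (stepwise<⇒<-preserving nthPrime nthPrime<nthPrime[1+k])

T-any⌊⌋⇔∃∈ : ∀ {A : Set} {P : A → Set} (P? : Decidable P) xs →
             T (any (λ x → ⌊ P? x ⌋) xs) ⇔ (∃[ x ] x ∈ xs × P x)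
T-any⌊⌋⇔∃∈ P? xs = mk⇔
  (λ t → Product.map₂ (Product.map₂ toWitness) (find (Equivalence.from any⇔ t)))
  (λ (x , x∈xs , px) → Equivalence.to any⇔ (lose x∈xs (fromWitness px)))

T-inX : ∀ X → T (inX X n) ⇔ n ∈ X
T-inX {n} X = mk⇔
  (λ t → let x , x∈X , n≡x = Equivalence.to (T-any⌊⌋⇔∃∈ (n ≟_) X) t in subst (_∈ X) (sym n≡x) x∈X)
  (λ n∈X → Equivalence.from (T-any⌊⌋⇔∃∈ (n ≟_) X) (n , n∈X , refl))

T-inX* : ∀ X → T (inX* X n) ⇔ (n ∈ X × n ≢ 1)
T-inX* X = mk⇔
  (λ t → let t∈ , t≢1 = Equivalence.to T-∧ t in Equivalence.to (T-inX X) t∈ , toWitnessFalse t≢1)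
  (λ (n∈X , n≢1) → Equivalence.from T-∧ (Equivalence.from (T-inX X) n∈X , fromWitnessFalse n≢1))

T-inρ : ∀ X → T (inρ X p) ⇔ (Prime p × ∃[ x ] x ∈ X × p ∣ x)
T-inρ {p} X = mk⇔
  (λ t → let tp , t∣ = Equivalence.to T-∧ t in toWitness tp , Equivalence.to (T-any⌊⌋⇔∃∈ (p ∣?_) X) t∣)
  (λ (pp , x∣) → Equivalence.from T-∧ (fromWitness pp , Equivalence.from (T-any⌊⌋⇔∃∈ (p ∣?_) X) x∣))

refinement-≡ : ∀ {A : Set} {f : A → Bool} {a b} {ha : T (f a)} {hb : T (f b)} →
               a ≡ b → _≡_ {A = Σ A (T ∘ f)} (a , ha) (b , hb)
refinement-≡ {ha = ha} {hb} refl = cong (_ ,_) (T-irrelevant ha hb)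

B-neighbour : ∀ {X} → All (0 <_) X → ∀ y → ∃[ z ] BAdj X y z
B-neighbour {X} _ (inj₁ (p , h)) =
  let pp , x , x∈X , p∣x = Equivalence.to (T-inρ X) h
      x≢1 x≡1 = prime∤1 pp (subst (p ∣_) x≡1 p∣x)
  in inj₂ (x , Equivalence.from (T-inX* X) (x∈X , x≢1)) , p∣x
B-neighbour {X} positive (inj₂ (x , h)) =
  let x∈X , x≢1 = Equivalence.to (T-inX* X) h
      p , pp , p∣x = primeFactor (≤∧≢⇒< (All.lookup positive x∈X) (x≢1 ∘ sym))
  in inj₁ (p , Equivalence.from (T-inρ X) (pp , x , x∈X , p∣x)) , p∣x

Iso⇒noIsolated : ∀ G {W AdjW} → Iso G W AdjW → (∀ w → ∃ (AdjW w)) → NoIsolatedVertices G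
Iso⇒noIsolated G {AdjW = AdjW} (f , adj⇔) neighbour v isolated =
  let open Inverse f
      w , fv~w = neighbour (to v)
  in isolated (from w)
       (Equivalence.from (adj⇔ v (from w)) (subst (AdjW (to v)) (sym (strictlyInverseˡ w)) fv~w))

noIsolated⇒nonEmpty : ∀ G → NoIsolatedVertices G → NonEmptyGraph G
noIsolated⇒nonEmpty G noIsolated (v , noEdges) = noIsolated v (noEdges v)

module DivisorLabelling (G : Graph) where

  vertex : Fin (size G) → V G
  vertex = Inverse.to (enum G)

  index : V G → ℕ
  index = toℕ ∘ Inverse.from (enum G)

  index-injective : ∀ {u v} → index u ≡ index v → u ≡ v
  index-injective {u} {v} index-u≡index-v =
    subst₂ _≡_ (strictlyInverseˡ u) (strictlyInverseˡ v) (cong vertex (toℕ-injective index-u≡index-v))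
    where open Inverse (enum G)

  vertices : List (V G)
  vertices = tabulate vertex

  ∈-vertices : ∀ v → v ∈ vertices
  ∈-vertices v = subst (_∈ vertices) (Inverse.strictlyInverseˡ (enum G) v) (∈-tabulate⁺ _)

  primeOf : V G → ℕ
  primeOf = nthPrime ∘ index

  primeOf-prime : ∀ v → Prime (primeOf v)
  primeOf-prime = nthPrime-prime ∘ index

  primeOf-injective : ∀ {u v} → primeOf u ≡ primeOf v → u ≡ v
  primeOf-injective = index-injective ∘ nthPrime-injective

  neighbours : V G → List (V G)
  neighbours v = filter (λ u → adj? G u v) vertices

  neighbourPrimes : V G → List ℕ
  neighbourPrimes v = map primeOf (neighbours v)

  neighbourPrimes-prime : ∀ v → All Prime (neighbourPrimes v)
  neighbourPrimes-prime v = map⁺ (All.tabulate (λ {u} _ → primeOf-prime u))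

  neighbourProduct : V G → ℕ
  neighbourProduct v = product (neighbourPrimes v)

  neighbourProduct-nonZero : ∀ v → NonZero (neighbourProduct v)
  neighbourProduct-nonZero v = productOfPrimes≢0 (neighbourPrimes-prime v)

  number : V G → ℕ
  number v = neighbourProduct v ^ suc (index v)

  adj⇒primeOf∣neighbourProduct : ∀ {u v} → Adj G u v → primeOf u ∣ neighbourProduct v
  adj⇒primeOf∣neighbourProduct {u} {v} u~v =
    ∈⇒∣product (∈-map⁺ primeOf (∈-filter⁺ (λ w → adj? G w v) (∈-vertices u) u~v))

  prime∣number⇒ : ∀ {v} → Prime q → q ∣ number v → ∃[ u ] Adj G u v × q ≡ primeOf u
  prime∣number⇒ {v = v} pq q∣number
    with q∣Π ← prime∣m^n⇒prime∣m (suc (index v)) pq q∣number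
    with u , _ , q≡primeOf-u , u~v ← ∈-map∘filter⁻ primeOf (λ u → adj? G u v) {xs = vertices}
           (factorisationHasAllPrimeFactors pq q∣Π (neighbourPrimes-prime v))
    = u , u~v , q≡primeOf-u

  primeOf∣number⇔adj : ∀ {u v} → primeOf u ∣ number v ⇔ Adj G u v
  primeOf∣number⇔adj {u} {v} = mk⇔ to from
    where
    to : primeOf u ∣ number v → Adj G u v
    to p∣n with w , w~v , primeOf-u≡primeOf-w ← prime∣number⇒ (primeOf-prime u) p∣n =
      subst (λ x → Adj G x v) (sym (primeOf-injective primeOf-u≡primeOf-w)) w~v
    from : Adj G u v → primeOf u ∣ number v
    from u~v = ∣-trans (adj⇒primeOf∣neighbourProduct u~v) (m∣m*n _)

  adj-resp-number : ∀ {u v w} → number u ≡ number v → Adj G w u → Adj G w v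
  adj-resp-number {w = w} nu≡nv w~u = Equivalence.to primeOf∣number⇔adj
    (subst (primeOf w ∣_) nu≡nv (Equivalence.from primeOf∣number⇔adj w~u))

  module WithoutIsolatedVertices (noIsolated : NoIsolatedVertices G) where

    neighbour : ∀ v → ∃[ u ] Adj G u v
    neighbour v with Any.any? (λ u → adj? G u v) vertices
    ... | yes some = Any.satisfied some
    ... | no none  = ⊥-elim (noIsolated v λ u v~u → none (lose (∈-vertices u) (Graph.sym G v~u)))

    1<neighbourProduct : ∀ v → 1 < neighbourProduct v
    1<neighbourProduct v with u , u~v ← neighbour v =
      prime∣⇒1< (primeOf-prime u) (adj⇒primeOf∣neighbourProduct u~v) {{neighbourProduct-nonZero v}}

    1<number : ∀ v → 1 < number v
    1<number v = ^-monoʳ-< (neighbourProduct v) (1<neighbourProduct v) (z<s {index v})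

    number-injective : ∀ {u v} → number u ≡ number v → u ≡ v
    number-injective {u} {v} nu≡nv =
      index-injective (suc-injective (^-injectiveʳ (1<neighbourProduct v) (begin
        neighbourProduct v ^ suc (index u) ≡⟨ cong (_^ suc (index u)) Πu≡Πv ⟨
        number u                           ≡⟨ nu≡nv ⟩
        number v                           ∎)))
      where
      open ≡-Reasoning
      same-neighbours : (λ w → Adj G w u) ≐ (λ w → Adj G w v)
      same-neighbours = adj-resp-number nu≡nv , adj-resp-number (sym nu≡nv)
      Πu≡Πv : neighbourProduct u ≡ neighbourProduct v
      Πu≡Πv = cong (product ∘ map primeOf)
                (filter-≐ (λ w → adj? G w u) (λ w → adj? G w v) same-neighbours vertices)

module Realisation (G : Graph) (noIsolated : NoIsolatedVertices G)
                   (colour : V G → Bool) (proper : ∀ u v → Adj G u v → colour u ≢ colour v) where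

  open DivisorLabelling G
  open WithoutIsolatedVertices noIsolated

  X : List ℕ
  X = map number (filter (λ v → colour v Bool.≟ false) vertices)

  ∈X : ∀ {v} → colour v ≡ false → number v ∈ X
  ∈X {v} cv≡false = ∈-map⁺ number (∈-filter⁺ (λ v → colour v Bool.≟ false) (∈-vertices v) cv≡false)

  ∈X⁻ : ∀ {x} → x ∈ X → ∃[ v ] colour v ≡ false × x ≡ number v
  ∈X⁻ x∈X
    with v , _ , x≡number-v , cv≡false ←
           ∈-map∘filter⁻ number (λ v → colour v Bool.≟ false) {xs = vertices} x∈X
    = v , cv≡false , x≡number-v

  X-positive : All (0 <_) X
  X-positive = All.tabulate λ x∈X →
    let v , _ , x≡number-v = ∈X⁻ x∈X in subst (0 <_) (sym x≡number-v) (<-trans z<s (1<number v))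

  X≢[] : ∀ {v} → colour v ≡ false → X ≢ []
  X≢[] cv≡false X≡[] with () ← subst (_ ∈_) X≡[] (∈X cv≡false)

  adj⇒colour≡not : ∀ {u v} → Adj G u v → colour u ≡ not (colour v)
  adj⇒colour≡not {u} {v} u~v = ¬-not (proper u v u~v)

  primeOf∈ρ : ∀ {v} → colour v ≡ true → T (inρ X (primeOf v))
  primeOf∈ρ {v} cv≡true =
    let u , u~v = neighbour v
        cu≡false = trans (adj⇒colour≡not u~v) (cong not cv≡true)
    in Equivalence.from (T-inρ X)
         (primeOf-prime v , number u , ∈X cu≡false , Equivalence.from primeOf∣number⇔adj (Graph.sym G u~v))

  number∈X* : ∀ {v} → colour v ≡ false → T (inX* X (number v))
  number∈X* {v} cv≡false =
    Equivalence.from (T-inX* X) (∈X cv≡false , λ nv≡1 → <⇒≢ (1<number v) (sym nv≡1))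

  -- The colour is abstracted together with its equation, so that lemmas about label can
  -- case on it while keeping the membership proofs.
  label′ : ∀ v b → colour v ≡ b → BVertex X
  label′ v true  cv≡true  = inj₁ (primeOf v , primeOf∈ρ cv≡true)
  label′ v false cv≡false = inj₂ (number v , number∈X* cv≡false)

  label : V G → BVertex X
  label v = label′ v (colour v) refl

  label′-injective : ∀ {u v} a b (cu≡a : colour u ≡ a) (cv≡b : colour v ≡ b) →
                     label′ u a cu≡a ≡ label′ v b cv≡b → u ≡ v
  label′-injective true  true  _ _ eq = primeOf-injective (,-injectiveˡ (inj₁-injective eq))
  label′-injective false false _ _ eq = number-injective (,-injectiveˡ (inj₂-injective eq))
  label′-injective true  false _ _ ()
  label′-injective false true  _ _ ()

  label-injective : ∀ {u v} → label u ≡ label v → u ≡ v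
  label-injective = label′-injective _ _ refl refl

  label′-adj : ∀ u v a b (cu≡a : colour u ≡ a) (cv≡b : colour v ≡ b) →
               Adj G u v ⇔ BAdj X (label′ u a cu≡a) (label′ v b cv≡b)
  label′-adj u v true  false _ _ = Function.Properties.Equivalence.sym primeOf∣number⇔adj
  label′-adj u v false true  _ _ =
    mk⇔ (Equivalence.from primeOf∣number⇔adj ∘ Graph.sym G) (Graph.sym G ∘ Equivalence.to primeOf∣number⇔adj)
  label′-adj u v true  true  cu≡a cv≡b = mk⇔ (λ u~v → ⊥-elim (proper u v u~v (trans cu≡a (sym cv≡b)))) λ ()
  label′-adj u v false false cu≡a cv≡b = mk⇔ (λ u~v → ⊥-elim (proper u v u~v (trans cu≡a (sym cv≡b)))) λ ()

  label-adj : ∀ u v → Adj G u v ⇔ BAdj X (label u) (label v)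
  label-adj u v = label′-adj u v _ _ refl refl

  label′≡inj₁ : ∀ {v} b (cv≡b : colour v ≡ b) → colour v ≡ true →
                ∀ {h} → label′ v b cv≡b ≡ inj₁ (primeOf v , h)
  label′≡inj₁ true  _ _ = cong inj₁ (refinement-≡ refl)
  label′≡inj₁ false cv≡false cv≡true with () ← trans (sym cv≡false) cv≡true

  label′≡inj₂ : ∀ {v} b (cv≡b : colour v ≡ b) → colour v ≡ false →
                ∀ {h} → label′ v b cv≡b ≡ inj₂ (number v , h)
  label′≡inj₂ false _ _ = cong inj₂ (refinement-≡ refl)
  label′≡inj₂ true cv≡true cv≡false with () ← trans (sym cv≡true) cv≡false

  label-surjective : ∀ y → ∃[ v ] label v ≡ y
  label-surjective (inj₁ (q , h))
    with pq , x , x∈X , q∣x ← Equivalence.to (T-inρ X) h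
    with v , cv≡false , refl ← ∈X⁻ x∈X
    with u , u~v , refl ← prime∣number⇒ pq q∣x
    = u , label′≡inj₁ _ refl (trans (adj⇒colour≡not u~v) (cong not cv≡false))
  label-surjective (inj₂ (x , h))
    with x∈X , _ ← Equivalence.to (T-inX* X) h
    with v , cv≡false , refl ← ∈X⁻ x∈X
    = v , label′≡inj₂ _ refl cv≡false

  isomorphism : IsoToB G X
  isomorphism = ⤖⇒↔ (mk⤖ (label-injective , surjective)) , label-adj
    where
    surjective : ∀ y → ∃[ v ] (∀ {w} → w ≡ v → label w ≡ y)
    surjective y with v , label-v≡y ← label-surjective y = v , λ { refl → label-v≡y }

theorem1p1 : (G : Graph) → Bipartite G →
    ((Σ (List ℕ) λ X → NonEmptyPositive X × IsoToB G X) ⇔ (NonEmptyGraph G × NoIsolatedVertices G))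
theorem1p1 G (colour , _ , (v , cv≡false) , proper) = mk⇔ realisable⇒ ⇒realisable
  where
  realisable⇒ : (Σ (List ℕ) λ X → NonEmptyPositive X × IsoToB G X) → NonEmptyGraph G × NoIsolatedVertices G
  realisable⇒ (X , (_ , positive) , iso) = noIsolated⇒nonEmpty G noIsolated , noIsolated
    where
    noIsolated : NoIsolatedVertices G
    noIsolated = Iso⇒noIsolated G iso (B-neighbour positive)

  ⇒realisable : NonEmptyGraph G × NoIsolatedVertices G → Σ (List ℕ) λ X → NonEmptyPositive X × IsoToB G X
  ⇒realisable (_ , noIsolated) = X , (X≢[] cv≡false , X-positive) , isomorphism
    where open Realisation G noIsolated colour proper
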